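{- The sentence $\Phi(256)$ is true.
   Context: Define $f:\mathbb{N}\setminus\{0\}\to\mathbb{N}\setminus\{0\}$ by $f(1)=1$, $f(n)=2^{2^{n-2}}$ for $n\in\{2,3,4,5\}$, and $f(n)=\left(2+2^{2^{n-4}}\right)^{2^{n-4}}$ for $n\geqslant 6$. For a positive integer $b$, $\Phi(b)$ is the sentence: for every positive integer $n$ and every system $T\subseteq\{x_i+1=x_k,\ x_i\cdot x_j=x_k:\ i,j,k\in\{1,\ldots,n\}\}$ all of whose solutions $(x_1,\ldots,x_n)$ in positive integers satisfy $x_1,\ldots,x_n\leqslant b$, each such solution satisfies $x_1,\ldots,x_n\leqslant f(n)$. -}

module Defs where

open import Data.Nat using (ℕ; zero; suc; _+_; _*_; _∸_; _^_; _≤_)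
open import Data.Fin using (Fin)
open import Data.List using (List)
open import Data.Product using (_×_)
open import Data.List.Membership.Propositional using (_∈_)
open import Relation.Binary.PropositionalEquality using (_≡_)

data Eqn (n : ℕ) : Set where
  addOne : (i k : Fin n) → Eqn n
  mul    : (i j k : Fin n) → Eqn n

Sat : {n : ℕ} → (Fin n → ℕ) → Eqn n → Set
Sat x (addOne i k) = x i + 1 ≡ x k
Sat x (mul i j k)  = x i * x j ≡ x k

IsPosSolution : {n : ℕ} → List (Eqn n) → (Fin n → ℕ) → Set
IsPosSolution {n} T x = (∀ i → 1 ≤ x i) × (∀ e → e ∈ T → Sat x e)


-- The function f (f 0 is irrelevant; n ranges over positive integers)
f : ℕ → ℕ
f 0 = 1
f 1 = 1
f 2 = 2 ^ (2 ^ 0)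
f 3 = 2 ^ (2 ^ 1)
f 4 = 2 ^ (2 ^ 2)
f 5 = 2 ^ (2 ^ 3)
f n@(suc (suc (suc (suc (suc (suc _)))))) = (2 + 2 ^ (2 ^ (n ∸ 4))) ^ (2 ^ (n ∸ 4))

Φ : ℕ → Set
Φ b = (n : ℕ) → 1 ≤ n → (T : List (Eqn n)) →
      ((x : Fin n → ℕ) → IsPosSolution T x → ∀ i → x i ≤ b) →
      (x : Fin n → ℕ) → IsPosSolution T x → ∀ i → x i ≤ f n

-- For n ≥ 5 we have f(n) ≥ 256, so there is nothing to prove.  For n ≤ 4, suppose a solution x
-- has a value above f(n), and let d > c > b > a (or fewer) be its distinct values, so that the
-- largest one exceeds f(k) for the number k ≤ 4 of values.  We build a map φ on these values
-- that preserves every relation u + 1 = w and u · v = w holding among them and sends some value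
-- above 256; then φ ∘ x is again a solution, contradicting the bound 256.
--
-- φ is built along the decreasing list of values.  If the largest value d is neither a successor
-- nor a product of two smaller values ≥ 2, send it to 257 and fix the others.  If d arises in
-- essentially one way, as u + 1 or as u · v, extend a map for the smaller values by φ(u) + 1 or
-- φ(u) · φ(v); that map exists by induction because f(k + 1) ≥ f(k)² for k ≤ 3.  The largest value
-- arises in two ways only if d = b² = c · a, where no two values are consecutive and squaring is a
-- homomorphism, or if d = c + 1 is also a², a · b or b², where φ is found by a finite search.
module Submission where

open import Defs
open import Data.Bool using (Bool; true; T; not; _∧_; _∨_; if_then_else_)
open import Data.Bool.ListAction using (all; any)
open import Data.Bool.Properties using (T-∧)
open import Data.Empty using (⊥-elim)
open import Data.Fin using (Fin)
open import Data.List using (List; []; _∷_; length; upTo; tabulate; deduplicate; cartesianProduct)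
open import Data.List.Membership.Propositional using (_∈_; find)
open import Data.List.Membership.Propositional.Properties
  using (∈-upTo⁺; ∈-cartesianProduct⁺; ∈-tabulate⁺; ∈-tabulate⁻; ∈-deduplicate⁺; ∈-deduplicate⁻)
open import Data.List.Properties using (length-deduplicate; length-tabulate)
open import Data.List.Relation.Binary.Permutation.Propositional using (↭-sym)
open import Data.List.Relation.Binary.Permutation.Propositional.Properties using (∈-resp-↭; ↭-length)
open import Data.List.Relation.Unary.All as All using (All; []; _∷_)
import Data.List.Relation.Unary.All.Properties as Allₚ
open import Data.List.Relation.Unary.AllPairs as AllPairs using (AllPairs; []; _∷_)
import Data.List.Relation.Unary.AllPairs.Properties as AllPairsₚ
open import Data.List.Relation.Unary.Any using (here; there)
open import Data.List.Relation.Unary.Any.Properties using (any⁻)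
open import Data.List.Relation.Unary.Linked.Properties using (Linked⇒AllPairs)
open import Data.List.Relation.Unary.Unique.DecPropositional.Properties using (deduplicate-!)
open import Data.Nat
open import Data.Nat.Divisibility using (_∣_; ∣1⇒≡1; ∣m+n∣m⇒∣n; n∣m*n; m∣m*n)
open import Data.Nat.Properties
open import Data.Product using (_×_; _,_; ∃-syntax; proj₁; proj₂)
open import Data.Sum using (_⊎_; inj₁; inj₂)
open import Function using (id; _∘_; Equivalence)
open import Level using (0ℓ)
open import Relation.Binary.Core using (Rel)
open import Relation.Binary.Definitions using (Symmetric)
open import Relation.Binary.Properties.DecTotalOrder ≤-decTotalOrder using (≥-decTotalOrder)
open import Data.List.Sort ≥-decTotalOrder using (sort; sort-↭; sort-↗)
open import Relation.Binary.PropositionalEquality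
open import Relation.Nullary using (¬_; ¬?; yes; no)

-- Homomorphisms on a finite set of values

record IsHomOn (V : List ℕ) (φ : ℕ → ℕ) : Set where
  field
    suc-hom  : ∀ {u w} → u ∈ V → w ∈ V → suc u ≡ w → suc (φ u) ≡ φ w
    *-hom    : ∀ {u v w} → u ∈ V → v ∈ V → w ∈ V → u * v ≡ w → φ u * φ v ≡ φ w
    positive : ∀ {v} → v ∈ V → 1 ≤ φ v

LiftsAbove : ℕ → List ℕ → Set
LiftsAbove B V = ∃[ φ ] IsHomOn V φ × ∃[ v ] v ∈ V × B < φ v

∘-solution : ∀ {n} {T : List (Eqn n)} {x : Fin n → ℕ} {V φ} →
             (∀ i → x i ∈ V) → IsHomOn V φ → IsPosSolution T x → IsPosSolution T (φ ∘ x)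
∘-solution {x = x} {φ = φ} x∈V hom (_ , sat) = (λ i → positive (x∈V i)) , λ e e∈T → sat-∘ e (sat e e∈T)
  where
  open IsHomOn hom
  sat-∘ : ∀ e → Sat x e → Sat (φ ∘ x) e
  sat-∘ (addOne i k) s = trans (+-comm (φ (x i)) 1) (suc-hom (x∈V i) (x∈V k) (trans (+-comm 1 (x i)) s))
  sat-∘ (mul i j k)  s = *-hom (x∈V i) (x∈V j) (x∈V k) s

id-hom : ∀ {V} → All (1 ≤_) V → IsHomOn V id
id-hom pos = record { suc-hom = λ _ _ e → e ; *-hom = λ _ _ _ e → e ; positive = All.lookup pos }

square-hom : ∀ {V} → All (1 ≤_) V → (∀ {u w} → u ∈ V → w ∈ V → suc u ≢ w) → IsHomOn V (λ x → x * x)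
square-hom pos no-succ = record
  { suc-hom  = λ u∈ w∈ e → ⊥-elim (no-succ u∈ w∈ e)
  ; *-hom    = λ {u} {v} _ _ _ → λ { refl → [m*n]*[o*p]≡[m*o]*[n*p] u u v v }
  ; positive = λ v∈ → *-mono-≤ (All.lookup pos v∈) (All.lookup pos v∈)
  }

m*n≡m⇒n≡1 : ∀ {m n} → 1 ≤ m → m * n ≡ m → n ≡ 1
m*n≡m⇒n≡1 {suc m} {n} _ e = *-cancelˡ-≡ n 1 (suc m) (trans e (sym (*-identityʳ (suc m))))

hom-one : ∀ {V φ} → IsHomOn V φ → 1 ∈ V → φ 1 ≡ 1
hom-one hom 1∈V = m*n≡m⇒n≡1 (positive 1∈V) (*-hom 1∈V 1∈V 1∈V refl)
  where open IsHomOn hom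

pairwise : ∀ {R : Rel ℕ 0ℓ} {xs} → Symmetric R → All (λ x → R x x) xs → AllPairs R xs →
           ∀ {u v} → u ∈ xs → v ∈ xs → R u v
pairwise sym (rxx ∷ _)  _          (here refl) (here refl) = rxx
pairwise sym _          (rx ∷ _)   (here refl) (there v∈) = All.lookup rx v∈
pairwise sym _          (rx ∷ _)   (there u∈)  (here refl) = sym (All.lookup rx u∈)
pairwise sym (_ ∷ diag) (_ ∷ rest) (there u∈)  (there v∈) = pairwise sym diag rest u∈ v∈

≤-head : ∀ {d v V} → All (_< d) V → v ∈ d ∷ V → v ≤ d
≤-head _     (here refl) = ≤-refl
≤-head below (there v∈)  = <⇒≤ (All.lookup below v∈)

ProperFactors : ℕ → ℕ → ℕ → Set
ProperFactors d u v = 2 ≤ u × 2 ≤ v × u * v ≡ d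

ProperFactors-sym : ∀ {d u v} → ProperFactors d u v → ProperFactors d v u
ProperFactors-sym {u = u} {v} (2≤u , 2≤v , e) = 2≤v , 2≤u , trans (*-comm v u) e

NotFactors : ℕ → ℕ → ℕ → Set
NotFactors d u v = ¬ ProperFactors d u v

SameUpToOrder : ℕ → ℕ → ℕ → ℕ → Set
SameUpToOrder p q u v = (u ≡ p × v ≡ q) ⊎ (u ≡ q × v ≡ p)

OnlyFactors : ℕ → ℕ → ℕ → ℕ → ℕ → Set
OnlyFactors d p q u v = ProperFactors d u v → SameUpToOrder p q u v

no-factors : ∀ {d xs} → All (λ x → NotFactors d x x) xs → AllPairs (NotFactors d) xs →
             ∀ {u v} → u ∈ xs → v ∈ xs → NotFactors d u v
no-factors = pairwise (λ ¬uv vu → ¬uv (ProperFactors-sym vu))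

only-factors : ∀ {d p q xs} → All (λ x → OnlyFactors d p q x x) xs → AllPairs (OnlyFactors d p q) xs →
               ∀ {u v} → u ∈ xs → v ∈ xs → OnlyFactors d p q u v
only-factors = pairwise λ only-uv vu → swap (only-uv (ProperFactors-sym vu))
  where
  swap : ∀ {p q u v} → SameUpToOrder p q u v → SameUpToOrder p q v u
  swap (inj₁ (u≡p , v≡q)) = inj₂ (v≡q , u≡p)
  swap (inj₂ (u≡q , v≡p)) = inj₁ (v≡p , u≡q)

chosen : ∀ {d p q} → OnlyFactors d p q p q
chosen _ = inj₁ (refl , refl)

not-product : ∀ {d u v} → u * v ≢ d → NotFactors d u v
not-product uv≢d (_ , _ , uv≡d) = uv≢d uv≡d

excluded : ∀ {d p q u v} → u * v ≢ d → OnlyFactors d p q u v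
excluded uv≢d = ⊥-elim ∘ not-product uv≢d

too-large : ∀ {d p q u v} → p * q ≡ d → p * q < u * v → OnlyFactors d p q u v
too-large refl pq<uv = excluded (>⇒≢ pq<uv)

Apart : ℕ → ℕ → Set
Apart u w = suc u ≢ w × suc w ≢ u

apart : ∀ {x y z} → y < z → z < x → Apart x y
apart y<z z<x = ≢-sym (<⇒≢ (m<n⇒m<1+n (<-trans y<z z<x))) , <⇒≢ (≤-<-trans y<z z<x)

adjacent-apart : ∀ {x y} → y < x → suc y ≢ x → Apart x y
adjacent-apart y<x 1+y≢x = ≢-sym (<⇒≢ (m<n⇒m<1+n y<x)) , 1+y≢x

*-mono-<-≤ : ∀ {x x′ y y′} → 1 ≤ y → x < x′ → y ≤ y′ → x * y < x′ * y′
*-mono-<-≤ {x′ = x′} {y} 1≤y x<x′ y≤y′ = <-≤-trans (*-monoˡ-< y {{>-nonZero 1≤y}} x<x′) (*-monoʳ-≤ x′ y≤y′)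

*-mono-≤-< : ∀ {x x′ y y′} → 1 ≤ x → x ≤ x′ → y < y′ → x * y < x′ * y′
*-mono-≤-< {x} {x′} {y} {y′} 1≤x x≤x′ y<y′ = subst₂ _<_ (*-comm y x) (*-comm y′ x′) (*-mono-<-≤ 1≤x y<y′ x≤x′)

m*n≢1+m : ∀ {m n} → 2 ≤ m → 1 ≤ n → m * n ≢ suc m
m*n≢1+m {m} {suc n} 2≤m _ e = <⇒≢ 2≤m (sym (m*n≡1⇒m≡1 m n (+-cancelˡ-≡ m _ _ m+mn≡m+1)))
  where
  m+mn≡m+1 : m + m * n ≡ m + 1
  m+mn≡m+1 = begin
    m + m * n  ≡⟨ *-suc m n ⟨
    m * suc n  ≡⟨ e ⟩
    suc m      ≡⟨ +-comm 1 m ⟩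
    m + 1      ∎
    where open ≡-Reasoning

m*n≡[1+n]²⇒n≡1 : ∀ {m n} → m * n ≡ suc n * suc n → n ≡ 1
m*n≡[1+n]²⇒n≡1 {m} {n} e = ∣1⇒≡1 (∣m+n∣m⇒∣n (subst (n ∣_) mn≡ (n∣m*n m)) (m∣m*n (suc (suc n))))
  where
  mn≡ : m * n ≡ n * suc (suc n) + 1
  mn≡ = begin
    m * n                  ≡⟨ e ⟩
    suc (n + n * suc n)    ≡⟨ cong suc (*-suc n (suc n)) ⟨
    suc (n * suc (suc n))  ≡⟨ +-comm 1 _ ⟩
    n * suc (suc n) + 1    ∎
    where open ≡-Reasoning

[1+n]*m<n*n : ∀ {m n} → m < n → suc n * m < n * n
[1+n]*m<n*n {m} {n} m<n = begin-strict
  m + n * m  <⟨ +-monoˡ-< (n * m) m<n ⟩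
  n + n * m  ≡⟨ *-suc n m ⟨
  n * suc m  ≤⟨ *-monoʳ-≤ n m<n ⟩
  n * n      ∎
  where open ≤-Reasoning

factor-bound : ∀ {t u v c} → t * t < u * v → u ≤ c → v ≤ c → t < c
factor-bound tt<uv u≤c v≤c = ≰⇒> λ c≤t → <⇒≱ tt<uv (*-mono-≤ (≤-trans u≤c c≤t) (≤-trans v≤c c≤t))

square-root-bound : ∀ {a} → a * a ≤ 256 → a < 17
square-root-bound aa≤256 = factor-bound (≤-<-trans aa≤256 (≤ᵇ⇒≤ 257 289 _)) ≤-refl ≤-refl

below-257 : ∀ {u d} → u < d → d ≤ 256 → u < 257
below-257 u<d d≤256 = <-≤-trans u<d (m≤n⇒m≤1+n d≤256)

-- Extending a homomorphism by a new largest value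

_[_↦_] : (ℕ → ℕ) → ℕ → ℕ → ℕ → ℕ
(φ [ d ↦ D ]) z with z ≟ d
... | yes _ = D
... | no  _ = φ z

[↦]-same : ∀ φ d D → (φ [ d ↦ D ]) d ≡ D
[↦]-same φ d D with d ≟ d
... | yes _  = refl
... | no d≢d = ⊥-elim (d≢d refl)

[↦]-other : ∀ {φ d D z} → z ≢ d → (φ [ d ↦ D ]) z ≡ φ z
[↦]-other {d = d} {z = z} z≢d with z ≟ d
... | yes z≡d = ⊥-elim (z≢d z≡d)
... | no  _   = refl

module Extension {d : ℕ} {V : List ℕ} (below : All (_< d) V) (pos : All (1 ≤_) V) (2≤d : 2 ≤ d) where

  extend-hom : ∀ {φ D} → IsHomOn V φ → 1 ≤ D →
               (∀ {u} → u ∈ V → suc u ≡ d → suc (φ u) ≡ D) →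
               (∀ {u v} → u ∈ V → v ∈ V → ProperFactors d u v → φ u * φ v ≡ D) →
               IsHomOn (d ∷ V) (φ [ d ↦ D ])
  extend-hom {φ} {D} hom 1≤D succ-d factors-d = record
    { suc-hom = suc-hom′ ; *-hom = *-hom′ ; positive = positive′ }
    where
    open IsHomOn hom
    ψ = φ [ d ↦ D ]

    ψ-d : ψ d ≡ D
    ψ-d = [↦]-same φ d D

    ψ-V : ∀ {v} → v ∈ V → ψ v ≡ φ v
    ψ-V v∈ = [↦]-other (<⇒≢ (All.lookup below v∈))

    pos′ : ∀ {v} → v ∈ d ∷ V → 1 ≤ v
    pos′ (here refl) = ≤-trans (s≤s z≤n) 2≤d
    pos′ (there v∈)  = All.lookup pos v∈

    d≤product : ∀ {v w} → v ∈ d ∷ V → d * v ≡ w → d ≤ w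
    d≤product v∈ refl = m≤m*n d _ {{>-nonZero (pos′ v∈)}}

    suc-hom′ : ∀ {u w} → u ∈ d ∷ V → w ∈ d ∷ V → suc u ≡ w → suc (ψ u) ≡ ψ w
    suc-hom′ (here refl) (here refl) e    = ⊥-elim (1+n≢n e)
    suc-hom′ (here refl) (there w∈)  refl = ⊥-elim (1+n≰n (<⇒≤ (All.lookup below w∈)))
    suc-hom′ (there u∈)  (here refl) e rewrite ψ-V u∈ | ψ-d = succ-d u∈ e
    suc-hom′ (there u∈)  (there w∈)  e rewrite ψ-V u∈ | ψ-V w∈ = suc-hom u∈ w∈ e

    *-hom′ : ∀ {u v w} → u ∈ d ∷ V → v ∈ d ∷ V → w ∈ d ∷ V → u * v ≡ w → ψ u * ψ v ≡ ψ w
    *-hom′ (here refl) v∈ (there w∈) e = ⊥-elim (<⇒≱ (All.lookup below w∈) (d≤product v∈ e))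
    *-hom′ {u} (there u∈) (here refl) (there w∈) e =
      ⊥-elim (<⇒≱ (All.lookup below w∈) (d≤product (there u∈) (trans (*-comm d u) e)))
    *-hom′ (there u∈) (there v∈) (there w∈) e rewrite ψ-V u∈ | ψ-V v∈ | ψ-V w∈ = *-hom u∈ v∈ w∈ e
    *-hom′ (here refl) (here refl) (here refl) e = ⊥-elim (<⇒≢ 2≤d (sym (m*n≡m⇒n≡1 (pos′ (here refl)) e)))
    *-hom′ (here refl) (there v∈) (here refl) e with refl ← m*n≡m⇒n≡1 (pos′ (here refl)) e
      rewrite ψ-V v∈ | ψ-d | hom-one hom v∈ = *-identityʳ D
    *-hom′ {u} (there u∈) (here refl) (here refl) e with refl ← m*n≡m⇒n≡1 (pos′ (here refl)) (trans (*-comm d u) e)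
      rewrite ψ-V u∈ | ψ-d | hom-one hom u∈ = *-identityˡ D
    *-hom′ {u} {v} (there u∈) (there v∈) (here refl) e with u ≟ 1 | v ≟ 1
    ... | yes refl | _        = ⊥-elim (<⇒≢ (All.lookup below v∈) (trans (sym (*-identityˡ v)) e))
    ... | no _     | yes refl = ⊥-elim (<⇒≢ (All.lookup below u∈) (trans (sym (*-identityʳ u)) e))
    ... | no u≢1   | no v≢1 rewrite ψ-V u∈ | ψ-V v∈ | ψ-d =
      factors-d u∈ v∈ (≤∧≢⇒< (All.lookup pos u∈) (u≢1 ∘ sym) , ≤∧≢⇒< (All.lookup pos v∈) (v≢1 ∘ sym) , e)

    positive′ : ∀ {v} → v ∈ d ∷ V → 1 ≤ ψ v
    positive′ (here refl) rewrite ψ-d  = 1≤D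
    positive′ (there v∈)  rewrite ψ-V v∈ = positive v∈

  lift-fresh : ∀ {B} → All (λ u → suc u ≢ d) V → (∀ {u v} → u ∈ V → v ∈ V → NotFactors d u v) →
               LiftsAbove B (d ∷ V)
  lift-fresh {B} no-succ no-factors =
    id [ d ↦ suc B ] ,
    extend-hom (id-hom pos) (s≤s z≤n) (λ u∈ e → ⊥-elim (All.lookup no-succ u∈ e))
                                      (λ u∈ v∈ uv → ⊥-elim (no-factors u∈ v∈ uv)) ,
    d , here refl , ≤-reflexive (sym ([↦]-same id d (suc B)))

  private
    lift-extension : ∀ {B φ D} → IsHomOn V φ → 1 ≤ D →
                     (∀ {u} → u ∈ V → suc u ≡ d → suc (φ u) ≡ D) →
                     (∀ {u v} → u ∈ V → v ∈ V → ProperFactors d u v → φ u * φ v ≡ D) →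
                     (∃[ v ] v ∈ V × B < φ v) → LiftsAbove B (d ∷ V)
    lift-extension {B} {φ} {D} hom 1≤D succ-d factors-d (v , v∈ , B<φv) =
      φ [ d ↦ D ] , extend-hom hom 1≤D succ-d factors-d ,
      v , there v∈ , subst (B <_) (sym ([↦]-other (<⇒≢ (All.lookup below v∈)))) B<φv

  lift-succ : ∀ {B c} → c ∈ V → suc c ≡ d → (∀ {u v} → u ∈ V → v ∈ V → NotFactors d u v) →
              LiftsAbove B V → LiftsAbove B (d ∷ V)
  lift-succ c∈ refl no-factors (φ , hom , big) =
    lift-extension hom (s≤s z≤n) (λ _ e → cong (suc ∘ φ) (suc-injective e))
                   (λ u∈ v∈ uv → ⊥-elim (no-factors u∈ v∈ uv)) big

  lift-product : ∀ {B p q} → p ∈ V → q ∈ V → All (λ u → suc u ≢ d) V →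
                 (∀ {u v} → u ∈ V → v ∈ V → OnlyFactors d p q u v) →
                 LiftsAbove B V → LiftsAbove B (d ∷ V)
  lift-product {p = p} {q} p∈ q∈ no-succ only-pq (φ , hom , big) =
    lift-extension hom (*-mono-≤ (positive p∈) (positive q∈)) (λ u∈ e → ⊥-elim (All.lookup no-succ u∈ e))
                   factors-d big
    where
    open IsHomOn hom
    factors-d : ∀ {u v} → u ∈ V → v ∈ V → ProperFactors d u v → φ u * φ v ≡ φ p * φ q
    factors-d u∈ v∈ uv with only-pq u∈ v∈ uv
    ... | inj₁ (refl , refl) = refl
    ... | inj₂ (refl , refl) = *-comm (φ q) (φ p)

-- Here b² = c a makes b + 1 = c and a + 1 = b impossible, so no two of the values are consecutive.
lift-square-of-middle : ∀ {t a b c} → AllPairs _>_ (b * b ∷ c ∷ b ∷ a ∷ []) → All (1 ≤_) (b * b ∷ c ∷ b ∷ a ∷ []) →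
                        c * a ≡ b * b → suc c ≢ b * b → t < b * b → LiftsAbove (t * t) (b * b ∷ c ∷ b ∷ a ∷ [])
lift-square-of-middle {a = a} {b} {c} ((c<d ∷ _) ∷ (b<c ∷ a<c ∷ []) ∷ (a<b ∷ []) ∷ [] ∷ []) pos
                      ca≡bb 1+c≢d t<d =
  (λ x → x * x) , square-hom pos (λ u∈ w∈ → proj₁ (all-apart u∈ w∈)) , b * b , here refl , *-mono-< t<d t<d
  where
  1+b≢c : suc b ≢ c
  1+b≢c 1+b≡c = <⇒≢ ([1+n]*m<n*n a<b) (trans (cong (_* a) 1+b≡c) ca≡bb)

  1+a≢b : suc a ≢ b
  1+a≢b 1+a≡b = <⇒≢ c<d (begin
    c      ≡⟨ *-identityʳ c ⟨
    c * 1  ≡⟨ cong (c *_) (m*n≡[1+n]²⇒n≡1 {c} (trans ca≡bb (cong₂ _*_ (sym 1+a≡b) (sym 1+a≡b)))) ⟨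
    c * a  ≡⟨ ca≡bb ⟩
    b * b  ∎)
    where open ≡-Reasoning

  diag : ∀ {x} → Apart x x
  diag = 1+n≢n , 1+n≢n

  all-apart : ∀ {u w} → u ∈ b * b ∷ c ∷ b ∷ a ∷ [] → w ∈ b * b ∷ c ∷ b ∷ a ∷ [] → Apart u w
  all-apart = pairwise (λ (p , q) → q , p) (diag ∷ diag ∷ diag ∷ diag ∷ [])
    ((adjacent-apart c<d 1+c≢d ∷ apart b<c c<d ∷ apart a<c c<d ∷ []) ∷
     (adjacent-apart b<c 1+b≢c ∷ apart a<b b<c ∷ []) ∷ (adjacent-apart a<b 1+a≢b ∷ []) ∷ [] ∷ [])

-- Finite search for homomorphisms

_⇒ᵇ_ : Bool → Bool → Bool
b ⇒ᵇ c = not b ∨ c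

modus-ponensᵇ : ∀ {b c} → T (b ⇒ᵇ c) → T b → T c
modus-ponensᵇ {true} c _ = c

lookupᵇ : ∀ {A : Set} {p : A → Bool} {xs x} → T (all p xs) → x ∈ xs → T (p x)
lookupᵇ {p = p} {xs} h = All.lookup (Allₚ.all⁺ p xs h)

tableMap : List ℕ → List ℕ → ℕ → ℕ
tableMap (v ∷ V) (w ∷ W) z = if z ≡ᵇ v then w else tableMap V W z
tableMap _       _       _ = 0

sucHomᵇ mulHomᵇ positiveᵇ isHomOnᵇ : List ℕ → (ℕ → ℕ) → Bool
sucHomᵇ   V φ = all (λ u → all (λ w → (suc u ≡ᵇ w) ⇒ᵇ (suc (φ u) ≡ᵇ φ w)) V) V
mulHomᵇ   V φ = all (λ u → all (λ v → all (λ w → (u * v ≡ᵇ w) ⇒ᵇ (φ u * φ v ≡ᵇ φ w)) V) V) V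
positiveᵇ V φ = all (λ v → 1 ≤ᵇ φ v) V
isHomOnᵇ  V φ = sucHomᵇ V φ ∧ mulHomᵇ V φ ∧ positiveᵇ V φ

isHomOnᵇ-sound : ∀ V φ → T (isHomOnᵇ V φ) → IsHomOn V φ
isHomOnᵇ-sound V φ h = record
  { suc-hom  = λ {u} {w} u∈ w∈ e →
      ≡ᵇ⇒≡ _ _ (modus-ponensᵇ (lookupᵇ (lookupᵇ suc-ok u∈) w∈) (≡⇒≡ᵇ (suc u) w e))
  ; *-hom    = λ {u} {v} {w} u∈ v∈ w∈ e →
      ≡ᵇ⇒≡ _ _ (modus-ponensᵇ (lookupᵇ (lookupᵇ (lookupᵇ mul-ok u∈) v∈) w∈) (≡⇒≡ᵇ (u * v) w e))
  ; positive = λ v∈ → ≤ᵇ⇒≤ 1 _ (lookupᵇ pos-ok v∈)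
  }
  where
  suc-ok = proj₁ (Equivalence.to (T-∧ {sucHomᵇ V φ}) h)
  rest   = proj₂ (Equivalence.to (T-∧ {sucHomᵇ V φ}) h)
  mul-ok = proj₁ (Equivalence.to (T-∧ {mulHomᵇ V φ}) rest)
  pos-ok = proj₂ (Equivalence.to (T-∧ {mulHomᵇ V φ}) rest)

liftsAboveᵇ : ℕ → List ℕ → List ℕ → Bool
liftsAboveᵇ B V W = isHomOnᵇ V (tableMap V W) ∧ any (λ v → B <ᵇ tableMap V W v) V

liftsAboveᵇ-sound : ∀ B V W → T (liftsAboveᵇ B V W) → LiftsAbove B V
liftsAboveᵇ-sound B V W h =
  let hom , big = Equivalence.to (T-∧ {isHomOnᵇ V (tableMap V W)}) h
      v , v∈ , B<φv = find (any⁻ _ V big)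
  in tableMap V W , isHomOnᵇ-sound V _ hom , v , v∈ , <ᵇ⇒< B _ B<φv

positiveDescendingᵇ : List ℕ → Bool
positiveDescendingᵇ []           = true
positiveDescendingᵇ (x ∷ [])     = 1 ≤ᵇ x
positiveDescendingᵇ (x ∷ y ∷ ys) = (y <ᵇ x) ∧ positiveDescendingᵇ (y ∷ ys)

positiveDescendingᵇ-complete : ∀ {V} → AllPairs _>_ V → All (1 ≤_) V → T (positiveDescendingᵇ V)
positiveDescendingᵇ-complete {[]}        _                  _         = _
positiveDescendingᵇ-complete {_ ∷ []}    _                  (1≤x ∷ _) = ≤⇒≤ᵇ 1≤x
positiveDescendingᵇ-complete {_ ∷ _ ∷ _} ((y<x ∷ _) ∷ desc) (_ ∷ pos) =
  Equivalence.from T-∧ (<⇒<ᵇ y<x , positiveDescendingᵇ-complete desc pos)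

record SearchProblem (X : Set) : Set where
  field
    premise    : X → Bool
    list       : X → List ℕ
    candidates : X → List (List ℕ)

searchᵇ : ∀ {X} → ℕ → SearchProblem X → List X → Bool
searchᵇ B S = all λ x → (premise x ∧ positiveDescendingᵇ (list x)) ⇒ᵇ any (liftsAboveᵇ B (list x)) (candidates x)
  where open SearchProblem S

search-sound : ∀ {X} B (S : SearchProblem X) xs → T (searchᵇ B S xs) → let open SearchProblem S in
               ∀ {x} → x ∈ xs → T (premise x) → AllPairs _>_ (list x) → All (1 ≤_) (list x) → LiftsAbove B (list x)
search-sound B S xs h {x} x∈ px desc pos =
  let W , _ , lifts = find (any⁻ _ (candidates x) (modus-ponensᵇ (lookupᵇ h x∈) admissible))
  in liftsAboveᵇ-sound B (list x) W lifts
  where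
  open SearchProblem S
  admissible = Equivalence.from T-∧ (px , positiveDescendingᵇ-complete desc pos)

squareAndPredecessor : SearchProblem ℕ
squareAndPredecessor = record
  { premise    = 2 <ᵇ_
  ; list       = λ a → a * a ∷ pred (a * a) ∷ a ∷ []
  ; candidates = λ _ → (289 ∷ 288 ∷ 17 ∷ []) ∷ []
  }

square-and-predecessor-table : T (searchᵇ 256 squareAndPredecessor (upTo 17))
square-and-predecessor-table = _

lift-square-and-predecessor : ∀ {a b} → 2 < a → a * a ≤ 256 → a * a ≡ suc b →
                                AllPairs _>_ (suc b ∷ b ∷ a ∷ []) → All (1 ≤_) (suc b ∷ b ∷ a ∷ []) →
                                LiftsAbove 256 (suc b ∷ b ∷ a ∷ [])
lift-square-and-predecessor {a} 2<a aa≤256 aa≡1+b desc pos =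
  subst (LiftsAbove 256) (sym list≡)
    (search-sound 256 squareAndPredecessor (upTo 17) square-and-predecessor-table
                  (∈-upTo⁺ (square-root-bound aa≤256)) (<⇒<ᵇ 2<a)
                  (subst (AllPairs _>_) list≡ desc) (subst (All (1 ≤_)) list≡ pos))
  where
  list≡ = cong (λ z → z ∷ pred z ∷ a ∷ []) (sym aa≡1+b)

productAndPredecessor : (ℕ → ℕ → ℕ) → (ℕ → ℕ → List (List ℕ)) → SearchProblem (ℕ × ℕ)
productAndPredecessor _·_ Ws = record
  { premise    = λ (a , b) → (16 <ᵇ a · b) ∧ (a · b ≤ᵇ 256)
  ; list       = λ (a , b) → a · b ∷ pred (a · b) ∷ b ∷ a ∷ []
  ; candidates = λ (a , b) → Ws a b
  }

-- The search domain is spelled out wherever it is used: hidden behind a name, it would be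
-- unfolded element by element when types are compared.
lift-product-and-predecessor :
  ∀ (_·_ : ℕ → ℕ → ℕ) Ws → T (searchᵇ 256 (productAndPredecessor _·_ Ws) (cartesianProduct (upTo 17) (upTo 257))) →
  ∀ {a b c} → a < 17 → b < 257 → a · b ≡ suc c → 16 < suc c → suc c ≤ 256 →
  AllPairs _>_ (suc c ∷ c ∷ b ∷ a ∷ []) → All (1 ≤_) (suc c ∷ c ∷ b ∷ a ∷ []) →
  LiftsAbove 256 (suc c ∷ c ∷ b ∷ a ∷ [])
lift-product-and-predecessor _·_ Ws table {a} {b} a<17 b<257 ab≡1+c 16<d d≤256 desc pos =
  subst (LiftsAbove 256) (sym list≡)
    (search-sound 256 (productAndPredecessor _·_ Ws) (cartesianProduct (upTo 17) (upTo 257)) table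
                  (∈-cartesianProduct⁺ (∈-upTo⁺ a<17) (∈-upTo⁺ b<257))
                  (Equivalence.from T-∧ (<⇒<ᵇ (subst (16 <_) d≡ab 16<d) , ≤⇒≤ᵇ (subst (_≤ 256) d≡ab d≤256)))
                  (subst (AllPairs _>_) list≡ desc) (subst (All (1 ≤_)) list≡ pos))
  where
  d≡ab  = sym ab≡1+c
  list≡ = cong (λ z → z ∷ pred z ∷ b ∷ a ∷ []) d≡ab

-- Images of (d, d − 1, b, a) with 17² > 256; which one works depends on the relations b takes part in.
a²-candidates ba-candidates b²-candidates : ℕ → ℕ → List (List ℕ)
a²-candidates _ b = (289 ∷ 288 ∷ 18 ∷ 17 ∷ []) ∷ (289 ∷ 288 ∷ 287 ∷ 17 ∷ []) ∷ (289 ∷ 288 ∷ b ∷ 17 ∷ []) ∷ []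
ba-candidates a _ = (306 ∷ 305 ∷ 18 ∷ 17 ∷ []) ∷ (4913 ∷ 4912 ∷ 289 ∷ 17 ∷ []) ∷ (17 * a ∷ pred (17 * a) ∷ 17 ∷ a ∷ []) ∷ []
b²-candidates a _ = (324 ∷ 323 ∷ 18 ∷ 17 ∷ []) ∷ (83521 ∷ 83520 ∷ 289 ∷ 17 ∷ []) ∷ (289 ∷ 288 ∷ 17 ∷ a ∷ []) ∷ []

a²-table : T (searchᵇ 256 (productAndPredecessor (λ a _ → a * a) a²-candidates) (cartesianProduct (upTo 17) (upTo 257)))
a²-table = _

ba-table : T (searchᵇ 256 (productAndPredecessor (λ a b → b * a) ba-candidates) (cartesianProduct (upTo 17) (upTo 257)))
ba-table = _

b²-table : T (searchᵇ 256 (productAndPredecessor (λ _ b → b * b) b²-candidates) (cartesianProduct (upTo 17) (upTo 257)))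
b²-table = _

-- Lifting at most four values

lifts₁ : ∀ {B a} → 1 < a → LiftsAbove B (a ∷ [])
lifts₁ 1<a = lift-fresh [] (λ ())
  where open Extension [] [] 1<a

lifts₂ : ∀ {B a b} → AllPairs _>_ (b ∷ a ∷ []) → All (1 ≤_) (b ∷ a ∷ []) → 2 < b → LiftsAbove B (b ∷ a ∷ [])
lifts₂ {B} {a} {b} (below ∷ _) (_ ∷ pos@(1≤a ∷ [])) 2<b = lift
  where
  open Extension below pos (<⇒≤ 2<b)

  lift : LiftsAbove B (b ∷ a ∷ [])
  lift with suc a ≟ b | a * a ≟ b
  ... | yes refl | _ =
    lift-succ (here refl) refl (no-factors ((λ (2≤a , _ , aa≡b) → m*n≢1+m 2≤a 1≤a aa≡b) ∷ []) ([] ∷ []))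
              (lifts₁ (≤-pred 2<b))
  ... | no 1+a≢b | yes refl =
    lift-product (here refl) (here refl) (1+a≢b ∷ []) (only-factors (chosen ∷ []) ([] ∷ []))
                 (lifts₁ (factor-bound (<⇒≤ 2<b) ≤-refl ≤-refl))
  ... | no 1+a≢b | no aa≢b = lift-fresh (1+a≢b ∷ []) (no-factors (not-product aa≢b ∷ []) ([] ∷ []))

lifts₃ : ∀ {a b c} → AllPairs _>_ (c ∷ b ∷ a ∷ []) → All (1 ≤_) (c ∷ b ∷ a ∷ []) → 4 < c → c ≤ 256 →
         LiftsAbove 256 (c ∷ b ∷ a ∷ [])
lifts₃ {a} {b} {c} desc@(below@(b<c ∷ _) ∷ desc′@((a<b ∷ []) ∷ _)) pos@(_ ∷ pos′@(1≤b ∷ 1≤a ∷ []))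
       4<c c≤256 = lift
  where
  open Extension below pos′ (≤-trans (≤ᵇ⇒≤ 2 5 _) 4<c)

  V′ = b ∷ a ∷ []
  b∈ : b ∈ V′
  b∈ = here refl
  a∈ : a ∈ V′
  a∈ = there (here refl)

  no-succ : suc b ≢ c → All (λ u → suc u ≢ c) V′
  no-succ 1+b≢c = 1+b≢c ∷ <⇒≢ (≤-<-trans a<b b<c) ∷ []

  by-product : ∀ {p q} → p ∈ V′ → q ∈ V′ → p * q ≡ c → suc b ≢ c →
               All (λ x → OnlyFactors c p q x x) V′ → AllPairs (OnlyFactors c p q) V′ → LiftsAbove 256 (c ∷ V′)
  by-product p∈ q∈ pq≡c 1+b≢c diag pairs =
    lift-product p∈ q∈ (no-succ 1+b≢c) (only-factors diag pairs)
      (lifts₂ desc′ pos′ (factor-bound (subst (4 <_) (sym pq≡c) 4<c) (≤-head (a<b ∷ []) p∈) (≤-head (a<b ∷ []) q∈)))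

  lift : LiftsAbove 256 (c ∷ V′)
  lift with suc b ≟ c
  lift | yes refl with a * a ≟ suc b
  ... | yes aa≡c = lift-square-and-predecessor (factor-bound (subst (4 <_) (sym aa≡c) 4<c) ≤-refl ≤-refl)
                                                 (subst (_≤ 256) (sym aa≡c) c≤256) aa≡c desc pos
  ... | no aa≢c  = lift-succ b∈ refl
    (no-factors ((λ (2≤b , _ , e) → m*n≢1+m 2≤b 1≤b e) ∷ not-product aa≢c ∷ [])
                (((λ (2≤b , _ , e) → m*n≢1+m 2≤b 1≤a e) ∷ []) ∷ [] ∷ []))
    (lifts₂ desc′ pos′ (≤-trans (n≤1+n 3) (≤-pred 4<c)))
  lift | no 1+b≢c with a * a ≟ c | b * a ≟ c | b * b ≟ c
  ... | yes aa≡c | _ | _ = by-product a∈ a∈ aa≡c 1+b≢c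
    (too-large aa≡c (*-mono-<-≤ 1≤a a<b (<⇒≤ a<b)) ∷ chosen ∷ [])
    ((too-large aa≡c (*-mono-<-≤ 1≤a a<b ≤-refl) ∷ []) ∷ [] ∷ [])
  ... | no aa≢c | yes ba≡c | _ = by-product b∈ a∈ ba≡c 1+b≢c
    (too-large ba≡c (*-mono-≤-< 1≤b ≤-refl a<b) ∷ excluded aa≢c ∷ []) ((chosen ∷ []) ∷ [] ∷ [])
  ... | no aa≢c | no ba≢c | yes bb≡c = by-product b∈ b∈ bb≡c 1+b≢c
    (chosen ∷ excluded aa≢c ∷ []) ((excluded ba≢c ∷ []) ∷ [] ∷ [])
  ... | no aa≢c | no ba≢c | no bb≢c = lift-fresh (no-succ 1+b≢c)
    (no-factors (not-product bb≢c ∷ not-product aa≢c ∷ []) ((not-product ba≢c ∷ []) ∷ [] ∷ []))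

lifts₄-succ : ∀ {a b c} → AllPairs _>_ (suc c ∷ c ∷ b ∷ a ∷ []) → All (1 ≤_) (suc c ∷ c ∷ b ∷ a ∷ []) →
              16 < suc c → suc c ≤ 256 → LiftsAbove 256 (suc c ∷ c ∷ b ∷ a ∷ [])
lifts₄-succ {a} {b} {c} desc@(below@(_ ∷ b<d ∷ _) ∷ desc′@(_ ∷ (a<b ∷ []) ∷ _))
            pos@(_ ∷ pos′@(1≤c ∷ 1≤b ∷ 1≤a ∷ [])) 16<d d≤256
  with a * a ≟ suc c | b * a ≟ suc c | b * b ≟ suc c
... | yes aa≡d | _ | _ = lift-product-and-predecessor (λ a _ → a * a) a²-candidates a²-table
  (square-root-bound (subst (_≤ 256) (sym aa≡d) d≤256)) (below-257 b<d d≤256) aa≡d 16<d d≤256 desc pos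
... | no _ | yes ba≡d | _ = lift-product-and-predecessor (λ a b → b * a) ba-candidates ba-table
  (square-root-bound (≤-trans (*-monoˡ-≤ a (<⇒≤ a<b)) (subst (_≤ 256) (sym ba≡d) d≤256)))
  (below-257 b<d d≤256) ba≡d 16<d d≤256 desc pos
... | no _ | no _ | yes bb≡d = lift-product-and-predecessor (λ _ b → b * b) b²-candidates b²-table
  (<-trans a<b (square-root-bound (subst (_≤ 256) (sym bb≡d) d≤256)))
  (below-257 b<d d≤256) bb≡d 16<d d≤256 desc pos
... | no aa≢d | no ba≢d | no bb≢d = lift-succ (here refl) refl
  (no-factors (c-multiple 1≤c ∷ not-product bb≢d ∷ not-product aa≢d ∷ [])
              ((c-multiple 1≤b ∷ c-multiple 1≤a ∷ []) ∷ (not-product ba≢d ∷ []) ∷ [] ∷ []))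
  (lifts₃ desc′ pos′ (<-≤-trans (≤ᵇ⇒≤ 5 16 _) (≤-pred 16<d)) (≤-trans (n≤1+n c) d≤256))
  where
  open Extension below pos′ (≤-trans (≤ᵇ⇒≤ 2 17 _) 16<d)
  c-multiple : ∀ {x} → 1 ≤ x → NotFactors (suc c) c x
  c-multiple 1≤x (2≤c , _ , cx≡d) = m*n≢1+m 2≤c 1≤x cx≡d

-- The six products of two of c > b > a are tried in increasing order; only c · a and b · b are
-- incomparable, and their coincidence is the case of lift-square-of-middle.
lifts₄-product : ∀ {a b c d} → AllPairs _>_ (d ∷ c ∷ b ∷ a ∷ []) → All (1 ≤_) (d ∷ c ∷ b ∷ a ∷ []) →
                 16 < d → d ≤ 256 → suc c ≢ d → LiftsAbove 256 (d ∷ c ∷ b ∷ a ∷ [])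
lifts₄-product {a} {b} {c} {d} desc@(below@(c<d ∷ _) ∷ desc′@(below′@(b<c ∷ a<c ∷ []) ∷ (a<b ∷ []) ∷ _))
               pos@(_ ∷ pos′@(1≤c ∷ 1≤b ∷ 1≤a ∷ [])) 16<d d≤256 1+c≢d = lift
  where
  open Extension below pos′ (≤-trans (≤ᵇ⇒≤ 2 17 _) 16<d)

  V′ = c ∷ b ∷ a ∷ []
  c∈ : c ∈ V′
  c∈ = here refl
  b∈ : b ∈ V′
  b∈ = there (here refl)
  a∈ : a ∈ V′
  a∈ = there (there (here refl))

  no-succ : All (λ u → suc u ≢ d) V′
  no-succ = 1+c≢d ∷ <⇒≢ (≤-<-trans b<c c<d) ∷ <⇒≢ (≤-<-trans a<c c<d) ∷ []

  by-product : ∀ {p q} → p ∈ V′ → q ∈ V′ → p * q ≡ d →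
               All (λ x → OnlyFactors d p q x x) V′ → AllPairs (OnlyFactors d p q) V′ → LiftsAbove 256 (d ∷ V′)
  by-product p∈ q∈ pq≡d diag pairs =
    lift-product p∈ q∈ no-succ (only-factors diag pairs)
      (lifts₃ desc′ pos′ (factor-bound (subst (16 <_) (sym pq≡d) 16<d) (≤-head below′ p∈) (≤-head below′ q∈))
              (≤-trans (<⇒≤ c<d) d≤256))

  lift : LiftsAbove 256 (d ∷ V′)
  lift with a * a ≟ d | b * a ≟ d | b * b ≟ d | c * a ≟ d | c * b ≟ d | c * c ≟ d
  ... | yes aa≡d | _ | _ | _ | _ | _ = by-product a∈ a∈ aa≡d
    (too-large aa≡d (*-mono-<-≤ 1≤a a<c (<⇒≤ a<c)) ∷ too-large aa≡d (*-mono-<-≤ 1≤a a<b (<⇒≤ a<b)) ∷ chosen ∷ [])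
    ((too-large aa≡d (*-mono-<-≤ 1≤a a<c (<⇒≤ a<b)) ∷ too-large aa≡d (*-mono-<-≤ 1≤a a<c ≤-refl) ∷ []) ∷
     (too-large aa≡d (*-mono-<-≤ 1≤a a<b ≤-refl) ∷ []) ∷ [] ∷ [])
  ... | no aa≢d | yes ba≡d | _ | _ | _ | _ = by-product b∈ a∈ ba≡d
    (too-large ba≡d (*-mono-<-≤ 1≤a b<c (<⇒≤ a<c)) ∷ too-large ba≡d (*-mono-≤-< 1≤b ≤-refl a<b) ∷ excluded aa≢d ∷ [])
    ((too-large ba≡d (*-mono-<-≤ 1≤a b<c (<⇒≤ a<b)) ∷ too-large ba≡d (*-mono-<-≤ 1≤a b<c ≤-refl) ∷ []) ∷
     (chosen ∷ []) ∷ [] ∷ [])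
  ... | no _ | no _ | yes refl | yes ca≡bb | _ | _ = lift-square-of-middle desc pos ca≡bb 1+c≢d 16<d
  ... | no aa≢d | no ba≢d | yes bb≡d | no ca≢d | _ | _ = by-product b∈ b∈ bb≡d
    (too-large bb≡d (*-mono-<-≤ 1≤b b<c (<⇒≤ b<c)) ∷ chosen ∷ excluded aa≢d ∷ [])
    ((too-large bb≡d (*-mono-<-≤ 1≤b b<c ≤-refl) ∷ excluded ca≢d ∷ []) ∷ (excluded ba≢d ∷ []) ∷ [] ∷ [])
  ... | no aa≢d | no ba≢d | no bb≢d | yes ca≡d | _ | _ = by-product c∈ a∈ ca≡d
    (too-large ca≡d (*-mono-≤-< 1≤c ≤-refl a<c) ∷ excluded bb≢d ∷ excluded aa≢d ∷ [])
    ((too-large ca≡d (*-mono-≤-< 1≤c ≤-refl a<b) ∷ chosen ∷ []) ∷ (excluded ba≢d ∷ []) ∷ [] ∷ [])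
  ... | no aa≢d | no ba≢d | no bb≢d | no ca≢d | yes cb≡d | _ = by-product c∈ b∈ cb≡d
    (too-large cb≡d (*-mono-≤-< 1≤c ≤-refl b<c) ∷ excluded bb≢d ∷ excluded aa≢d ∷ [])
    ((chosen ∷ excluded ca≢d ∷ []) ∷ (excluded ba≢d ∷ []) ∷ [] ∷ [])
  ... | no aa≢d | no ba≢d | no bb≢d | no ca≢d | no cb≢d | yes cc≡d = by-product c∈ c∈ cc≡d
    (chosen ∷ excluded bb≢d ∷ excluded aa≢d ∷ [])
    ((excluded cb≢d ∷ excluded ca≢d ∷ []) ∷ (excluded ba≢d ∷ []) ∷ [] ∷ [])
  ... | no aa≢d | no ba≢d | no bb≢d | no ca≢d | no cb≢d | no cc≢d = lift-fresh no-succ (no-factors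
    (not-product cc≢d ∷ not-product bb≢d ∷ not-product aa≢d ∷ [])
    ((not-product cb≢d ∷ not-product ca≢d ∷ []) ∷ (not-product ba≢d ∷ []) ∷ [] ∷ []))

lifts₄ : ∀ {a b c d} → AllPairs _>_ (d ∷ c ∷ b ∷ a ∷ []) → All (1 ≤_) (d ∷ c ∷ b ∷ a ∷ []) →
         16 < d → d ≤ 256 → LiftsAbove 256 (d ∷ c ∷ b ∷ a ∷ [])
lifts₄ {c = c} {d} desc pos 16<d d≤256 with suc c ≟ d
... | yes refl = lifts₄-succ desc pos 16<d d≤256
... | no 1+c≢d = lifts₄-product desc pos 16<d d≤256 1+c≢d

lifts : ∀ {V} → AllPairs _>_ V → All (1 ≤_) V → All (_≤ 256) V → length V ≤ 4 →
        ∀ {v} → v ∈ V → f (length V) < v → LiftsAbove 256 V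
lifts {_ ∷ []}             _                _   _             _ (here refl) 1<a = lifts₁ 1<a
lifts {_ ∷ _ ∷ []}         desc@(below ∷ _) pos _             _ v∈ 2<v = lifts₂ desc pos (<-≤-trans 2<v (≤-head below v∈))
lifts {_ ∷ _ ∷ _ ∷ []}     desc@(below ∷ _) pos (c≤256 ∷ _) _ v∈ 4<v =
  lifts₃ desc pos (<-≤-trans 4<v (≤-head below v∈)) c≤256
lifts {_ ∷ _ ∷ _ ∷ _ ∷ []} desc@(below ∷ _) pos (d≤256 ∷ _) _ v∈ 16<v =
  lifts₄ desc pos (<-≤-trans 16<v (≤-head below v∈)) d≤256
lifts {_ ∷ _ ∷ _ ∷ _ ∷ _ ∷ _} _ _ _ (s≤s (s≤s (s≤s (s≤s ())))) _ _

AllPairs-deduplicate⁺ : ∀ {R : Rel ℕ 0ℓ} {xs} → AllPairs R xs → AllPairs R (deduplicate _≟_ xs)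
AllPairs-deduplicate⁺ []         = []
AllPairs-deduplicate⁺ (rx ∷ rxs) =
  Allₚ.filter⁺ (¬? ∘ (_ ≟_)) (Allₚ.deduplicate⁺ _≟_ rx) ∷ AllPairsₚ.filter⁺ (¬? ∘ (_ ≟_)) (AllPairs-deduplicate⁺ rxs)

values : ∀ {n} → (Fin n → ℕ) → List ℕ
values x = deduplicate _≟_ (sort (tabulate x))

∈-values⁺ : ∀ {n} (x : Fin n → ℕ) i → x i ∈ values x
∈-values⁺ x i = ∈-deduplicate⁺ _≟_ (∈-resp-↭ (↭-sym (sort-↭ _)) (∈-tabulate⁺ i))

∈-values⁻ : ∀ {n} (x : Fin n → ℕ) {v} → v ∈ values x → ∃[ i ] v ≡ x i
∈-values⁻ x v∈ = ∈-tabulate⁻ (∈-resp-↭ (sort-↭ _) (∈-deduplicate⁻ _≟_ _ v∈))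

values-All : ∀ {n} {P : ℕ → Set} (x : Fin n → ℕ) → (∀ i → P (x i)) → All P (values x)
values-All {P = P} x px = All.tabulate λ v∈ → let i , v≡xi = ∈-values⁻ x v∈ in subst P (sym v≡xi) (px i)

values-descending : ∀ {n} (x : Fin n → ℕ) → AllPairs _>_ (values x)
values-descending x = AllPairs.zipWith (λ (y≤x , x≢y) → ≤∧≢⇒< y≤x (≢-sym x≢y))
  (AllPairs-deduplicate⁺ (Linked⇒AllPairs (λ y≤x z≤y → ≤-trans z≤y y≤x) (sort-↗ _)) , deduplicate-! _≟_ _)

length-values : ∀ {n} (x : Fin n → ℕ) → length (values x) ≤ n
length-values x =
  ≤-trans (length-deduplicate _≟_ (sort (tabulate x))) (≤-reflexive (trans (↭-length (sort-↭ (tabulate x))) (length-tabulate x)))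

f-step : ∀ k → k < 4 → f k ≤ f (suc k)
f-step 0 _ = ≤-refl
f-step 1 _ = ≤ᵇ⇒≤ 1 2 _
f-step 2 _ = ≤ᵇ⇒≤ 2 4 _
f-step 3 _ = ≤ᵇ⇒≤ 4 16 _
f-step (suc (suc (suc (suc _)))) (s≤s (s≤s (s≤s (s≤s ()))))

f-mono : ∀ {k n} → k ≤ n → n ≤ 4 → f k ≤ f n
f-mono {n = zero}  z≤n   _     = ≤-refl
f-mono {n = suc n} k≤1+n 1+n≤4 with m≤n⇒m<n∨m≡n k≤1+n
... | inj₁ k<1+n = ≤-trans (f-mono (≤-pred k<1+n) (<⇒≤ 1+n≤4)) (f-step n 1+n≤4)
... | inj₂ refl  = ≤-refl

256≤f : ∀ n → 4 < n → 256 ≤ f n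
256≤f 1 (s≤s ())
256≤f 2 (s≤s (s≤s ()))
256≤f 3 (s≤s (s≤s (s≤s ())))
256≤f 4 (s≤s (s≤s (s≤s (s≤s ()))))
256≤f 5 _ = ≤-refl
256≤f n@(suc (suc (suc (suc (suc (suc m)))))) _ = begin
  4 ^ 4            ≤⟨ ^-monoʳ-≤ 4 4≤e ⟩
  4 ^ e            ≤⟨ ^-monoˡ-≤ e (≤-trans (^-monoʳ-≤ 2 (≤-trans (≤ᵇ⇒≤ 2 4 _) 4≤e)) (m≤n+m (2 ^ e) 2)) ⟩
  (2 + 2 ^ e) ^ e  ∎
  where
  open ≤-Reasoning
  e = 2 ^ (n ∸ 4)
  4≤e : 4 ≤ e
  4≤e = ^-monoʳ-≤ 2 (m≤m+n 2 m)

theorem10 : Φ 256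
theorem10 n _ _ bounded x sol@(positive , _) i with n ≤? 4 | x i ≤? f n
... | no n≰4  | _         = ≤-trans (bounded x sol i) (256≤f n (≰⇒> n≰4))
... | yes _   | yes xi≤fn = xi≤fn
... | yes n≤4 | no xi≰fn
  with φ , hom , v , v∈ , 256<φv ← lifts (values-descending x) (values-All x positive) (values-All x (bounded x sol))
                                           (≤-trans (length-values x) n≤4) (∈-values⁺ x i)
                                           (≤-<-trans (f-mono (length-values x) n≤4) (≰⇒> xi≰fn))
  with j , refl ← ∈-values⁻ x v∈
  = ⊥-elim (<⇒≱ 256<φv (bounded (φ ∘ x) (∘-solution (∈-values⁺ x) hom sol) j))
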